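{- Let $f=m_1+\dots+m_t$ be a $k$-homogeneous $n$-variable Boolean function, with $m_1,\dots,m_t$ the distinct monomials of its ANF. Then \[|N_k(f)|=\sum_{\ell=1}^{t}(-2)^{\ell-1}\sum_{\{i_1,\dots,i_\ell\}\subseteq[t],\ |\{i_1,\dots,i_\ell\}|=\ell}\left|\bigcap_{j=1}^{\ell}N_k(m_{i_j})\right|.\]
   Context: An $n$-variable Boolean function $f\colon\mathbb{F}_2^n\to\mathbb{F}_2$ is written in algebraic normal form (ANF) as a sum of distinct monomials $\prod_{i\in I}x_i$, $I\subseteq[n]$; it is $k$-homogeneous if all these monomials have degree $k$. For a Boolean function $g$, $N_k(g)$ denotes the set of $k$-dimensional linear subspaces $U$ of $\mathbb{F}_2^n$ with $\sum_{x\in U}g(x)\neq 0$. $[t]=\{1,\dots,t\}$. -}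

module Defs where

open import Data.Bool using (Bool; true; false; _∧_; _∨_; _xor_; not; if_then_else_)
open import Data.Nat using (ℕ; zero; suc; _≡ᵇ_)
open import Data.Fin using (Fin)
open import Data.Fin.Subset using (Subset; ∣_∣)
open import Data.Vec using (Vec; []; _∷_; lookup; replicate; zipWith; foldr; toList; allFin)
open import Data.List using (List; []; _∷_; map; concatMap; filterᵇ; length; upTo)
open import Data.Bool.ListAction using (all; any)
open import Data.Integer using (ℤ; +_; -_; _+_; _*_; _^_)
open import Data.Product using (_×_; _,_)

F₂^ : ℕ → Set
F₂^ n = Vec Bool n

_⊕_ : ∀ {n} → F₂^ n → F₂^ n → F₂^ n
_⊕_ = zipWith _xor_

𝟎 : ∀ {n} → F₂^ n
𝟎 = replicate _ false

_==_ : ∀ {n} → F₂^ n → F₂^ n → Bool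
[] == [] = true
(a ∷ x) == (b ∷ y) = not (a xor b) ∧ (x == y)

tuples : ∀ {A : Set} → List A → (k : ℕ) → List (Vec A k)
tuples xs zero = [] ∷ []
tuples xs (suc k) = concatMap (λ a → map (a ∷_) (tuples xs k)) xs

points : (n : ℕ) → List (F₂^ n)
points n = tuples (false ∷ true ∷ []) n

-- A truth table on F₂ⁿ (equivalently a subset of F₂ⁿ).
Table : ℕ → Set
Table zero = Bool
Table (suc n) = Table n × Table n   -- (value at x₀ = 0 , value at x₀ = 1)

_∋_ : ∀ {n} → Table n → F₂^ n → Bool
_∋_ {zero} b [] = b
_∋_ {suc n} (t₀ , t₁) (false ∷ x) = t₀ ∋ x
_∋_ {suc n} (t₀ , t₁) (true ∷ x) = t₁ ∋ x

-- enumeration of all subsets of F₂ⁿ (each exactly once)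
allTables : (n : ℕ) → List (Table n)
allTables zero = false ∷ true ∷ []
allTables (suc n) = concatMap (λ a → map (a ,_) (allTables n)) (allTables n)

lincomb : ∀ {n k} → Vec Bool k → Vec (F₂^ n) k → F₂^ n
lincomb [] [] = 𝟎
lincomb (c ∷ cs) (b ∷ bs) = (if c then b else 𝟎) ⊕ lincomb cs bs

-- S is a linear subspace (contains 0, closed under addition;
-- scalar multiplication over F₂ is then automatic)
isSubspace : ∀ {n} → Table n → Bool
isSubspace {n} S =
  (S ∋ 𝟎) ∧ all (λ x → all (λ y → not ((S ∋ x) ∧ (S ∋ y)) ∨ (S ∋ (x ⊕ y))) (points n)) (points n)

isBasisOf : ∀ {n k} → Vec (F₂^ n) k → Table n → Bool
isBasisOf {n} {k} b S =
  all (λ v → S ∋ v) (toList b)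
  ∧ all (λ c → not (lincomb c b == 𝟎) ∨ (c == 𝟎)) (points k)
  ∧ all (λ x → not (S ∋ x) ∨ any (λ c → lincomb c b == x) (points k)) (points n)

isSubspaceOfDim : ∀ {n} → ℕ → Table n → Bool
isSubspaceOfDim {n} k S = isSubspace S ∧ any (λ b → isBasisOf b S) (tuples (points n) k)

sumOver : ∀ {n} → Table n → (F₂^ n → Bool) → Bool
sumOver {n} U g = Data.List.foldr _xor_ false (map g (filterᵇ (λ x → U ∋ x) (points n)))

inN : ∀ {n} → ℕ → (F₂^ n → Bool) → Table n → Bool
inN k g U = isSubspaceOfDim k U ∧ sumOver U g

card-N : (n k : ℕ) → (F₂^ n → Bool) → ℕ
card-N n k g = length (filterᵇ (inN k g) (allTables n))

card-⋂N : (n k : ℕ) → List (F₂^ n → Bool) → ℕ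
card-⋂N n k gs = length (filterᵇ (λ U → all (λ g → inN k g U) gs) (allTables n))

monomial : ∀ {n} → Subset n → F₂^ n → Bool
monomial I x = foldr _ _∧_ true (zipWith (λ i xi → not i ∨ xi) I x)

anf : ∀ {n t} → Vec (Subset n) t → F₂^ n → Bool
anf ms x = foldr _ _xor_ false (Data.Vec.map (λ I → monomial I x) ms)

members : ∀ {t} → Subset t → List (Fin t)
members {t} J = filterᵇ (lookup J) (toList (allFin t))

Σℤ : ∀ {A : Set} → List A → (A → ℤ) → ℤ
Σℤ xs f = Data.List.foldr (λ a s → f a + s) (+ 0) xs

rhs : (n k t : ℕ) → Vec (Subset n) t → ℤ
rhs n k t ms =
  Σℤ (map suc (upTo t)) (λ ℓ →
    ((- (+ 2)) ^ (ℓ Data.Nat.∸ 1)) *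
      Σℤ (filterᵇ (λ J → ∣ J ∣ ≡ᵇ ℓ) (points t)) (λ J →
        + card-⋂N n k (map (λ j → monomial (lookup ms j)) (members J))))

{-# OPTIONS --safe #-}
-- Writing ⟦b⟧ ∈ {0,1} for a bit b, one has 1 - 2⟦b₁ ⊕ ⋯ ⊕ bₜ⟧ = ∏ⱼ (1 - 2⟦bⱼ⟧)
-- = Σ_{J ⊆ [t]} (-2)^|J| ∏_{j ∈ J} ⟦bⱼ⟧, and subtracting the J = ∅ term and dividing
-- by -2 gives ⟦b₁ ⊕ ⋯ ⊕ bₜ⟧ = Σ_{∅ ≠ J ⊆ [t]} (-2)^(|J|-1) ∏_{j ∈ J} ⟦bⱼ⟧.
-- Since Σ_{x ∈ U} is F₂-linear, U ∈ N_k(m₁ + ⋯ + mₜ) exactly when an odd number of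
-- the statements U ∈ N_k(mⱼ) hold; apply the identity to these bits and sum over U.
module Submission where

open import Defs
open import Algebra using (CommutativeRing)
import Algebra.Properties.CommutativeSemigroup as CommutativeSemigroupProperties
open import Data.Bool using (Bool; true; false; _∧_; _xor_; if_then_else_)
open import Data.Bool.ListAction using (all; and)
open import Data.Bool.Properties using (∧-zeroʳ; ∧-distribˡ-xor; xor-∧-commutativeRing)
open import Data.Fin using (Fin; zero; suc)
open import Data.Fin.Subset using (Subset; ∣_∣; inside; outside)
open import Data.Fin.Subset.Properties using (∣p∣≤n)
open import Data.Integer using (ℤ; +_; _+_; _-_; _*_; -_; _^_)
import Data.Integer.Properties as ℤ
open import Data.List as List using (List; []; _∷_; _++_; map; filterᵇ; length; upTo)
import Data.List.Properties as List
open import Data.Nat using (ℕ; zero; suc; _∸_; _≡ᵇ_; _<_; _≤_; s≤s)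
open import Data.Vec using (Vec; []; _∷_; lookup; toList; allFin)
import Data.Vec.Properties as Vec
import Data.Vec.Functional as Vector
open import Function using (_∘_)
open import Relation.Binary.PropositionalEquality
  using (_≡_; refl; sym; trans; cong; cong₂; _≗_; module ≡-Reasoning)

open CommutativeSemigroupProperties ℤ.+-commutativeSemigroup
  using () renaming (interchange to +-interchange)
open CommutativeSemigroupProperties
  (CommutativeRing.+-commutativeSemigroup xor-∧-commutativeRing)
  using () renaming (interchange to xor-interchange)

⟦_⟧ : Bool → ℤ
⟦ true ⟧ = + 1
⟦ false ⟧ = + 0

⨁ : ∀ {t} → (Fin t → Bool) → Bool
⨁ = Vector.foldr _xor_ false

xorCoefficient : ℕ → ℤ
xorCoefficient zero = + 0
xorCoefficient (suc ℓ) = (- + 2) ^ ℓ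

module _ {A : Set} where

  Σ-cong : (xs : List A) {f g : A → ℤ} → f ≗ g → Σℤ xs f ≡ Σℤ xs g
  Σ-cong [] f≗g = refl
  Σ-cong (x ∷ xs) f≗g = cong₂ _+_ (f≗g x) (Σ-cong xs f≗g)

  Σ-zero : (xs : List A) → Σℤ xs (λ _ → + 0) ≡ + 0
  Σ-zero [] = refl
  Σ-zero (x ∷ xs) = trans (ℤ.+-identityˡ _) (Σ-zero xs)

  Σ-distrib-+ : (xs : List A) (f g : A → ℤ) → Σℤ xs (λ x → f x + g x) ≡ Σℤ xs f + Σℤ xs g
  Σ-distrib-+ [] f g = refl
  Σ-distrib-+ (x ∷ xs) f g =
    trans (cong (_+_ (f x + g x)) (Σ-distrib-+ xs f g)) (+-interchange (f x) (g x) _ _)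

  Σ-++ : (xs ys : List A) (f : A → ℤ) → Σℤ (xs ++ ys) f ≡ Σℤ xs f + Σℤ ys f
  Σ-++ [] ys f = sym (ℤ.+-identityˡ _)
  Σ-++ (x ∷ xs) ys f = trans (cong (_+_ (f x)) (Σ-++ xs ys f)) (sym (ℤ.+-assoc (f x) _ _))

  *-distribˡ-Σ : (c : ℤ) (xs : List A) (f : A → ℤ) → c * Σℤ xs f ≡ Σℤ xs (λ x → c * f x)
  *-distribˡ-Σ c [] f = ℤ.*-zeroʳ c
  *-distribˡ-Σ c (x ∷ xs) f =
    trans (ℤ.*-distribˡ-+ c (f x) _) (cong (_+_ (c * f x)) (*-distribˡ-Σ c xs f))

  *-distribˡ-Σ-filterᵇ : (c : ℤ) (p : A → Bool) (xs : List A) (f : A → ℤ) →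
    c * Σℤ (filterᵇ p xs) f ≡ Σℤ xs (λ x → if p x then c * f x else + 0)
  *-distribˡ-Σ-filterᵇ c p [] f = ℤ.*-zeroʳ c
  *-distribˡ-Σ-filterᵇ c p (x ∷ xs) f with p x
  ... | true = trans (ℤ.*-distribˡ-+ c (f x) _) (cong (_+_ (c * f x)) (*-distribˡ-Σ-filterᵇ c p xs f))
  ... | false = trans (*-distribˡ-Σ-filterᵇ c p xs f) (sym (ℤ.+-identityˡ _))

  length-filterᵇ : (p : A → Bool) (xs : List A) → + length (filterᵇ p xs) ≡ Σℤ xs (λ x → ⟦ p x ⟧)
  length-filterᵇ p [] = refl
  length-filterᵇ p (x ∷ xs) with p x
  ... | true = cong (_+_ (+ 1)) (length-filterᵇ p xs)
  ... | false = trans (length-filterᵇ p xs) (sym (ℤ.+-identityˡ _))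

  Σ-map : {B : Set} (g : B → A) (xs : List B) (f : A → ℤ) → Σℤ (map g xs) f ≡ Σℤ xs (f ∘ g)
  Σ-map g [] f = refl
  Σ-map g (x ∷ xs) f = cong (_+_ (f (g x))) (Σ-map g xs f)

Σ-swap : ∀ {A B : Set} (xs : List A) (ys : List B) (f : A → B → ℤ) →
  Σℤ xs (λ x → Σℤ ys (f x)) ≡ Σℤ ys (λ y → Σℤ xs (λ x → f x y))
Σ-swap [] ys f = sym (Σ-zero ys)
Σ-swap (x ∷ xs) ys f = trans (cong (_+_ (Σℤ ys (f x))) (Σ-swap xs ys f))
  (sym (Σ-distrib-+ ys (f x) (λ y → Σℤ xs (λ x → f x y))))

Σ-upTo-suc : ∀ t (f : ℕ → ℤ) → Σℤ (upTo (suc t)) f ≡ f 0 + Σℤ (upTo t) (f ∘ suc)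
Σ-upTo-suc t f = cong (_+_ (f 0))
  (trans (cong (λ xs → Σℤ xs f) (sym (List.map-upTo suc t))) (Σ-map suc (upTo t) f))

Σ-upTo-pick : ∀ {t m} (g : ℕ → ℤ) → m < t → Σℤ (upTo t) (λ i → if m ≡ᵇ i then g i else + 0) ≡ g m
Σ-upTo-pick {suc t} {zero} g _ = trans (Σ-upTo-suc t (λ i → if 0 ≡ᵇ i then g i else + 0))
  (trans (cong (_+_ (g 0)) (Σ-zero (upTo t))) (ℤ.+-identityʳ (g 0)))
Σ-upTo-pick {suc t} {suc m} g (s≤s m<t) = trans (Σ-upTo-suc t (λ i → if suc m ≡ᵇ i then g i else + 0))
  (trans (ℤ.+-identityˡ _) (Σ-upTo-pick (g ∘ suc) m<t))

Σ-sizes-pick : ∀ t m (y : ℤ) → m ≤ t →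
  Σℤ (map suc (upTo t)) (λ ℓ → if m ≡ᵇ ℓ then (- + 2) ^ (ℓ ∸ 1) * y else + 0) ≡ xorCoefficient m * y
Σ-sizes-pick t zero y _ =
  trans (Σ-map suc (upTo t) (λ ℓ → if 0 ≡ᵇ ℓ then (- + 2) ^ (ℓ ∸ 1) * y else + 0))
    (Σ-zero (upTo t))
Σ-sizes-pick t (suc m) y m<t =
  trans (Σ-map suc (upTo t) (λ ℓ → if suc m ≡ᵇ ℓ then (- + 2) ^ (ℓ ∸ 1) * y else + 0))
    (Σ-upTo-pick (λ i → (- + 2) ^ i * y) m<t)

Σ-group-by-size : ∀ t (K : Subset t → ℤ) →
  Σℤ (map suc (upTo t)) (λ ℓ → (- + 2) ^ (ℓ ∸ 1) * Σℤ (filterᵇ (λ J → ∣ J ∣ ≡ᵇ ℓ) (points t)) K)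
    ≡ Σℤ (points t) (λ J → xorCoefficient ∣ J ∣ * K J)
Σ-group-by-size t K = begin
  Σℤ sizes (λ ℓ → c ℓ * Σℤ (filterᵇ (λ J → ∣ J ∣ ≡ᵇ ℓ) (points t)) K)
    ≡⟨ Σ-cong sizes (λ ℓ → *-distribˡ-Σ-filterᵇ (c ℓ) (λ J → ∣ J ∣ ≡ᵇ ℓ) (points t) K) ⟩
  Σℤ sizes (λ ℓ → Σℤ (points t) (λ J → if ∣ J ∣ ≡ᵇ ℓ then c ℓ * K J else + 0))
    ≡⟨ Σ-swap sizes (points t) (λ ℓ J → if ∣ J ∣ ≡ᵇ ℓ then c ℓ * K J else + 0) ⟩
  Σℤ (points t) (λ J → Σℤ sizes (λ ℓ → if ∣ J ∣ ≡ᵇ ℓ then c ℓ * K J else + 0))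
    ≡⟨ Σ-cong (points t) (λ J → Σ-sizes-pick t ∣ J ∣ (K J) (∣p∣≤n J)) ⟩
  Σℤ (points t) (λ J → xorCoefficient ∣ J ∣ * K J)
    ∎
  where
  open ≡-Reasoning
  sizes = map suc (upTo t)
  c : ℕ → ℤ
  c ℓ = (- + 2) ^ (ℓ ∸ 1)

filterᵇ-map : ∀ {A B : Set} (p : B → Bool) (f : A → B) (xs : List A) →
  filterᵇ p (map f xs) ≡ map f (filterᵇ (p ∘ f) xs)
filterᵇ-map p f [] = refl
filterᵇ-map p f (x ∷ xs) with p (f x)
... | true = cong (f x ∷_) (filterᵇ-map p f xs)
... | false = filterᵇ-map p f xs

all-map : ∀ {A B : Set} (p : B → Bool) (f : A → B) (xs : List A) → all p (map f xs) ≡ all (p ∘ f) xs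
all-map p f xs = cong and (sym (List.map-∘ xs))

toList-allFin-suc : ∀ t → toList (allFin (suc t)) ≡ zero ∷ map suc (toList (allFin t))
toList-allFin-suc t =
  trans (cong toList (Vec.allFin-map t)) (cong (zero ∷_) (Vec.toList-map suc (allFin t)))

members-outside : ∀ {t} (J : Subset t) → members (outside ∷ J) ≡ map suc (members J)
members-outside {t} J = trans (cong (filterᵇ (lookup (outside ∷ J))) (toList-allFin-suc t))
  (filterᵇ-map (lookup (outside ∷ J)) suc (toList (allFin t)))

members-inside : ∀ {t} (J : Subset t) → members (inside ∷ J) ≡ zero ∷ map suc (members J)
members-inside {t} J = trans (cong (filterᵇ (lookup (inside ∷ J))) (toList-allFin-suc t))
  (cong (zero ∷_) (filterᵇ-map (lookup (inside ∷ J)) suc (toList (allFin t))))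

subsetSum : ∀ {t} → (ℕ → ℤ) → (Fin t → Bool) → ℤ
subsetSum {t} w h = Σℤ (points t) (λ J → w ∣ J ∣ * ⟦ all h (members J) ⟧)

Σ-points-suc : ∀ t (f : Vec Bool (suc t) → ℤ) →
  Σℤ (points (suc t)) f ≡ Σℤ (points t) (f ∘ (outside ∷_)) + Σℤ (points t) (f ∘ (inside ∷_))
Σ-points-suc t f = begin
  Σℤ (map (outside ∷_) (points t) ++ map (inside ∷_) (points t) ++ []) f
    ≡⟨ Σ-++ (map (outside ∷_) (points t)) (map (inside ∷_) (points t) ++ []) f ⟩
  Σℤ (map (outside ∷_) (points t)) f + Σℤ (map (inside ∷_) (points t) ++ []) f
    ≡⟨ cong₂ _+_ (Σ-map (outside ∷_) (points t) f)
         (trans (cong (λ xs → Σℤ xs f) (List.++-identityʳ (map (inside ∷_) (points t))))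
                (Σ-map (inside ∷_) (points t) f)) ⟩
  Σℤ (points t) (f ∘ (outside ∷_)) + Σℤ (points t) (f ∘ (inside ∷_))
    ∎
  where open ≡-Reasoning

subsetSum-suc : ∀ {t} (w : ℕ → ℤ) (h : Fin (suc t) → Bool) →
  subsetSum w h ≡ subsetSum w (h ∘ suc) + ⟦ h zero ⟧ * subsetSum (w ∘ suc) (h ∘ suc)
subsetSum-suc {t} w h = begin
  subsetSum w h
    ≡⟨ Σ-points-suc t (λ J → w ∣ J ∣ * ⟦ all h (members J) ⟧) ⟩
  Σℤ (points t) (λ J → w ∣ J ∣ * ⟦ all h (members (outside ∷ J)) ⟧)
    + Σℤ (points t) (λ J → w (suc ∣ J ∣) * ⟦ all h (members (inside ∷ J)) ⟧)
    ≡⟨ cong₂ _+_ (Σ-cong (points t) outside-term) (Σ-cong (points t) inside-term) ⟩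
  subsetSum w h′ + Σℤ (points t) (λ J → ⟦ h zero ⟧ * (w (suc ∣ J ∣) * ⟦ all h′ (members J) ⟧))
    ≡⟨ cong (_+_ (subsetSum w h′))
         (sym (*-distribˡ-Σ ⟦ h zero ⟧ (points t) (λ J → w (suc ∣ J ∣) * ⟦ all h′ (members J) ⟧))) ⟩
  subsetSum w h′ + ⟦ h zero ⟧ * subsetSum (w ∘ suc) h′
    ∎
  where
  open ≡-Reasoning
  h′ = h ∘ suc

  outside-term : ∀ J → w ∣ J ∣ * ⟦ all h (members (outside ∷ J)) ⟧ ≡ w ∣ J ∣ * ⟦ all h′ (members J) ⟧
  outside-term J = cong (λ b → w ∣ J ∣ * ⟦ b ⟧)
    (trans (cong (all h) (members-outside J)) (all-map h suc (members J)))

  *-⟦∧⟧ : ∀ x y (a : ℤ) → a * ⟦ x ∧ y ⟧ ≡ ⟦ x ⟧ * (a * ⟦ y ⟧)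
  *-⟦∧⟧ true y a = sym (ℤ.*-identityˡ (a * ⟦ y ⟧))
  *-⟦∧⟧ false y a = ℤ.*-zeroʳ a

  inside-term : ∀ J → w (suc ∣ J ∣) * ⟦ all h (members (inside ∷ J)) ⟧
                    ≡ ⟦ h zero ⟧ * (w (suc ∣ J ∣) * ⟦ all h′ (members J) ⟧)
  inside-term J = trans
    (cong (λ b → w (suc ∣ J ∣) * ⟦ b ⟧)
      (trans (cong (all h) (members-inside J)) (cong (h zero ∧_) (all-map h suc (members J)))))
    (*-⟦∧⟧ (h zero) (all h′ (members J)) (w (suc ∣ J ∣)))

subsetSum-scale : ∀ {t} (c : ℤ) (w : ℕ → ℤ) (h : Fin t → Bool) →
  subsetSum (λ m → c * w m) h ≡ c * subsetSum w h
subsetSum-scale {t} c w h = trans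
  (Σ-cong (points t) (λ J → ℤ.*-assoc c (w ∣ J ∣) ⟦ all h (members J) ⟧))
  (sym (*-distribˡ-Σ c (points t) (λ J → w ∣ J ∣ * ⟦ all h (members J) ⟧)))

xor-sign-expansion : ∀ {t} (h : Fin t → Bool) → subsetSum ((- + 2) ^_) h ≡ + 1 - + 2 * ⟦ ⨁ h ⟧
xor-sign-expansion {zero} h = refl
xor-sign-expansion {suc t} h = begin
  subsetSum ((- + 2) ^_) h
    ≡⟨ subsetSum-suc ((- + 2) ^_) h ⟩
  subsetSum ((- + 2) ^_) (h ∘ suc) + ⟦ h zero ⟧ * subsetSum (λ m → - + 2 * (- + 2) ^ m) (h ∘ suc)
    ≡⟨ cong₂ (λ a b → a + ⟦ h zero ⟧ * b) (xor-sign-expansion (h ∘ suc))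
         (trans (subsetSum-scale (- + 2) ((- + 2) ^_) (h ∘ suc))
                (cong (- + 2 *_) (xor-sign-expansion (h ∘ suc)))) ⟩
  (+ 1 - + 2 * ⟦ ⨁ (h ∘ suc) ⟧) + ⟦ h zero ⟧ * (- + 2 * (+ 1 - + 2 * ⟦ ⨁ (h ∘ suc) ⟧))
    ≡⟨ sign-step (h zero) (⨁ (h ∘ suc)) ⟩
  + 1 - + 2 * ⟦ ⨁ h ⟧
    ∎
  where
  open ≡-Reasoning
  sign-step : ∀ x y → (+ 1 - + 2 * ⟦ y ⟧) + ⟦ x ⟧ * (- + 2 * (+ 1 - + 2 * ⟦ y ⟧)) ≡ + 1 - + 2 * ⟦ x xor y ⟧
  sign-step false false = refl
  sign-step false true = refl
  sign-step true false = refl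
  sign-step true true = refl

xor-indicator-expansion : ∀ {t} (h : Fin t → Bool) → subsetSum xorCoefficient h ≡ ⟦ ⨁ h ⟧
xor-indicator-expansion {zero} h = refl
xor-indicator-expansion {suc t} h = begin
  subsetSum xorCoefficient h
    ≡⟨ subsetSum-suc xorCoefficient h ⟩
  subsetSum xorCoefficient (h ∘ suc) + ⟦ h zero ⟧ * subsetSum ((- + 2) ^_) (h ∘ suc)
    ≡⟨ cong₂ (λ a b → a + ⟦ h zero ⟧ * b) (xor-indicator-expansion (h ∘ suc)) (xor-sign-expansion (h ∘ suc)) ⟩
  ⟦ ⨁ (h ∘ suc) ⟧ + ⟦ h zero ⟧ * (+ 1 - + 2 * ⟦ ⨁ (h ∘ suc) ⟧)
    ≡⟨ indicator-step (h zero) (⨁ (h ∘ suc)) ⟩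
  ⟦ ⨁ h ⟧
    ∎
  where
  open ≡-Reasoning
  indicator-step : ∀ x y → ⟦ y ⟧ + ⟦ x ⟧ * (+ 1 - + 2 * ⟦ y ⟧) ≡ ⟦ x xor y ⟧
  indicator-step false false = refl
  indicator-step false true = refl
  indicator-step true false = refl
  indicator-step true true = refl

module _ {A : Set} where

  foldr-xor-false : (xs : List A) → List.foldr _xor_ false (map (λ _ → false) xs) ≡ false
  foldr-xor-false [] = refl
  foldr-xor-false (x ∷ xs) = foldr-xor-false xs

  foldr-xor-distrib : (xs : List A) (f g : A → Bool) →
    List.foldr _xor_ false (map (λ x → f x xor g x) xs)
      ≡ List.foldr _xor_ false (map f xs) xor List.foldr _xor_ false (map g xs)
  foldr-xor-distrib [] f g = refl
  foldr-xor-distrib (x ∷ xs) f g =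
    trans (cong (_xor_ (f x xor g x)) (foldr-xor-distrib xs f g)) (xor-interchange (f x) (g x) _ _)

sumOver-cong : ∀ {n} (U : Table n) {f g : F₂^ n → Bool} → f ≗ g → sumOver U f ≡ sumOver U g
sumOver-cong {n} U f≗g = cong (List.foldr _xor_ false) (List.map-cong f≗g (filterᵇ (U ∋_) (points n)))

sumOver-⨁ : ∀ {n t} (U : Table n) (g : Fin t → F₂^ n → Bool) →
  sumOver U (λ x → ⨁ (λ j → g j x)) ≡ ⨁ (λ j → sumOver U (g j))
sumOver-⨁ {n} {zero} U g = foldr-xor-false (filterᵇ (U ∋_) (points n))
sumOver-⨁ {n} {suc t} U g = trans
  (foldr-xor-distrib (filterᵇ (U ∋_) (points n)) (g zero) (λ x → ⨁ (λ j → g (suc j) x)))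
  (cong (_xor_ (sumOver U (g zero))) (sumOver-⨁ U (g ∘ suc)))

∧-distribˡ-⨁ : ∀ {t} (b : Bool) (h : Fin t → Bool) → b ∧ ⨁ h ≡ ⨁ (λ j → b ∧ h j)
∧-distribˡ-⨁ {zero} b h = ∧-zeroʳ b
∧-distribˡ-⨁ {suc t} b h =
  trans (∧-distribˡ-xor b (h zero) (⨁ (h ∘ suc))) (cong (_xor_ (b ∧ h zero)) (∧-distribˡ-⨁ b (h ∘ suc)))

inN-⨁ : ∀ {n t} k (f : F₂^ n → Bool) (g : Fin t → F₂^ n → Bool) → f ≗ (λ x → ⨁ (λ j → g j x)) →
  (U : Table n) → inN k f U ≡ ⨁ (λ j → inN k (g j) U)
inN-⨁ k f g f≗⨁g U = trans
  (cong (isSubspaceOfDim k U ∧_) (trans (sumOver-cong U f≗⨁g) (sumOver-⨁ U g)))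
  (∧-distribˡ-⨁ (isSubspaceOfDim k U) (λ j → sumOver U (g j)))

anf-≗-⨁ : ∀ {n t} (ms : Vec (Subset n) t) → anf ms ≗ (λ x → ⨁ (λ j → monomial (lookup ms j) x))
anf-≗-⨁ [] x = refl
anf-≗-⨁ (m ∷ ms) x = cong (_xor_ (monomial m x)) (anf-≗-⨁ ms x)

card-⋂N≡Σ : ∀ {n t} k (g : Fin t → F₂^ n → Bool) (J : Subset t) →
  + card-⋂N n k (map g (members J)) ≡ Σℤ (allTables n) (λ U → ⟦ all (λ j → inN k (g j) U) (members J) ⟧)
card-⋂N≡Σ {n} k g J = trans
  (length-filterᵇ (λ U → all (λ f → inN k f U) (map g (members J))) (allTables n))
  (Σ-cong (allTables n) (λ U → cong ⟦_⟧ (all-map (λ f → inN k f U) g (members J))))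

card-N-⨁ : ∀ {n t} k (f : F₂^ n → Bool) (g : Fin t → F₂^ n → Bool) → f ≗ (λ x → ⨁ (λ j → g j x)) →
  + card-N n k f ≡ Σℤ (points t) (λ J → xorCoefficient ∣ J ∣ * + card-⋂N n k (map g (members J)))
card-N-⨁ {n} {t} k f g f≗⨁g = begin
  + card-N n k f
    ≡⟨ length-filterᵇ (inN k f) (allTables n) ⟩
  Σℤ (allTables n) (λ U → ⟦ inN k f U ⟧)
    ≡⟨ Σ-cong (allTables n) (λ U → cong ⟦_⟧ (inN-⨁ k f g f≗⨁g U)) ⟩
  Σℤ (allTables n) (λ U → ⟦ ⨁ (λ j → inN k (g j) U) ⟧)
    ≡⟨ Σ-cong (allTables n) (λ U → sym (xor-indicator-expansion (λ j → inN k (g j) U))) ⟩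
  Σℤ (allTables n) (λ U → Σℤ (points t) (λ J → xorCoefficient ∣ J ∣ * ⟦ all∈ J U ⟧))
    ≡⟨ Σ-swap (allTables n) (points t) (λ U J → xorCoefficient ∣ J ∣ * ⟦ all∈ J U ⟧) ⟩
  Σℤ (points t) (λ J → Σℤ (allTables n) (λ U → xorCoefficient ∣ J ∣ * ⟦ all∈ J U ⟧))
    ≡⟨ Σ-cong (points t) (λ J →
         sym (*-distribˡ-Σ (xorCoefficient ∣ J ∣) (allTables n) (λ U → ⟦ all∈ J U ⟧))) ⟩
  Σℤ (points t) (λ J → xorCoefficient ∣ J ∣ * Σℤ (allTables n) (λ U → ⟦ all∈ J U ⟧))
    ≡⟨ Σ-cong (points t) (λ J → cong (xorCoefficient ∣ J ∣ *_) (sym (card-⋂N≡Σ k g J))) ⟩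
  Σℤ (points t) (λ J → xorCoefficient ∣ J ∣ * + card-⋂N n k (map g (members J)))
    ∎
  where
  open ≡-Reasoning
  all∈ : Subset t → Table n → Bool
  all∈ J U = all (λ j → inN k (g j) U) (members J)

theorem4p2 : (n k t : ℕ) (ms : Vec (Subset n) t)
    → (∀ i j → lookup ms i ≡ lookup ms j → i ≡ j)
    → (∀ i → ∣ lookup ms i ∣ ≡ k)
    → + card-N n k (anf ms) ≡ rhs n k t ms
theorem4p2 n k t ms _ _ = begin
  + card-N n k (anf ms)
    ≡⟨ card-N-⨁ k (anf ms) m (anf-≗-⨁ ms) ⟩
  Σℤ (points t) (λ J → xorCoefficient ∣ J ∣ * ∣⋂N∣ J)
    ≡⟨ sym (Σ-group-by-size t ∣⋂N∣) ⟩
  rhs n k t ms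
    ∎
  where
  open ≡-Reasoning
  m : Fin t → F₂^ n → Bool
  m j = monomial (lookup ms j)
  ∣⋂N∣ : Subset t → ℤ
  ∣⋂N∣ J = + card-⋂N n k (map m (members J))
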